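{- Let $p$ be an odd prime, $g$ a generator of $\mathbb{Z}_p^*$, and $x$ an integer with $0<x<p-1$. Then $g^x\in\mathcal{M}(g)$ if and only if $x\in A(p-1)$.
   Context: For an integer $n>0$, $A(n)=\{x\in\mathbb{Z}: 0<x<n,\ \gcd(x,n)=1,\ \gcd(x-2,n)>1,\ \gcd(x+2,n)>1\}$. For an odd prime $p$: $\mathcal{G}$ is the set of generators of $\mathbb{Z}_p^*$, $\mathcal{R}$ the set of quadratic residues in $\mathbb{Z}_p^*$, $\mathcal{NG}$ the set of quadratic non-residues that are not generators. For $g\in\mathcal{G}$: $\mathcal{R}_g=\{r\in\mathcal{R}: gr\in\mathcal{G}\}$, $\mathcal{I}(g)=\mathcal{R}_g\cap\mathcal{R}_{g^{ -1}}$, and $\mathcal{M}(g)=\mathcal{G}\setminus\{gr,\ g^{ -1}r : r\in\mathcal{I}(g)\}$ (products mod $p$). -}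

module Defs where

open import Data.Nat.Base using (ℕ; zero; suc; _+_; _*_; _∸_; _^_; _<_; _≤_; _%_; NonZero; ∣_-_∣)
open import Data.Nat.GCD using (gcd)
open import Data.Product using (Σ; _×_; ∃)
open import Relation.Binary.PropositionalEquality using (_≡_; _≢_)
open import Relation.Nullary using (¬_)

-- Elements of ℤ_p^* are represented by their residues a with 0 < a < p.
Unit : ℕ → ℕ → Set
Unit p a = 0 < a × a < p

module _ (p : ℕ) .{{_ : NonZero p}} where

  IsGenerator : ℕ → Set
  IsGenerator g = Unit p g × ((a : ℕ) → Unit p a → ∃ λ k → g ^ k % p ≡ a)

  IsQR : ℕ → Set
  IsQR r = Unit p r × ∃ λ y → (y * y) % p ≡ r

  -- inverse of g in ℤ_p^* (via Fermat: g⁻¹ = g^(p-2) mod p, for p prime)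
  inv : ℕ → ℕ
  inv g = g ^ (p ∸ 2) % p

  InR : ℕ → ℕ → Set
  InR g r = IsQR r × IsGenerator ((g * r) % p)

  InI : ℕ → ℕ → Set
  InI g r = InR g r × InR (inv g) r

  InM : ℕ → ℕ → Set
  InM g m = IsGenerator m ×
            ((r : ℕ) → InI g r → m ≢ (g * r) % p × m ≢ (inv g * r) % p)

InA : ℕ → ℕ → Set
InA n x = 0 < x × x < n × gcd x n ≡ 1
        × 1 < gcd ∣ x - 2 ∣ n × 1 < gcd (x + 2) n

{-# OPTIONS --safe #-}

-- Write units as powers gᵏ of the generator. The order of g is exactly n = p - 1 (by two
-- pigeonhole arguments), so the exponent k is determined modulo n; gᵏ is a generator iff
-- gcd(k, n) = 1, and a quadratic residue iff k is even. Hence r = g²ᵗ lies in 𝓘(g) iff 2t + 1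
-- and 2t - 1 are coprime to n, and gˣ = g·r resp. gˣ = g⁻¹·r iff x ≡ 2t + 1 resp. x ≡ 2t - 1.
-- Since n is even, a generator gˣ has x odd, so gˣ avoids every g·r iff x - 2 is not coprime
-- to n, and every g⁻¹·r iff x + 2 is not.

module Submission where

open import Defs
open import Data.Nat.Base
open import Data.Nat.Properties
open import Data.Nat.DivMod
open import Data.Nat.Divisibility
open import Data.Nat.GCD
open import Data.Nat.Coprimality using (gcd≡1⇒coprime; coprime-Bézout)
open import Data.Nat.Primality using (Prime; euclidsLemma; prime⇒irreducible; ¬prime[0]; ¬prime[1])
open import Data.Nat.Tactic.RingSolver using (solve-∀)
open import Data.Fin.Base using (Fin; toℕ; fromℕ<)
open import Data.Fin.Properties
  using (pigeonhole; injective⇒≤; toℕ-injective; toℕ-fromℕ<; fromℕ<-injective; toℕ<n; toℕ≤pred[n])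
open import Data.Product using (∃; _×_; _,_; proj₁; proj₂)
open import Data.Sum using (_⊎_; inj₁; inj₂; fromInj₂)
open import Function.Bundles using (_⇔_; mk⇔)
open import Function.Definitions using (Injective)
open import Relation.Nullary using (¬_; contradiction)
open import Relation.Binary.PropositionalEquality

open ≡-Reasoning

%≡%⇒∣∣-∣ : ∀ a b n .{{_ : NonZero n}} → a % n ≡ b % n → n ∣ ∣ a - b ∣
%≡%⇒∣∣-∣ a b n eq = divides ∣ a / n - b / n ∣ (begin
  ∣ a - b ∣                                 ≡⟨ cong₂ ∣_-_∣ (m≡m%n+[m/n]*n a n) (m≡m%n+[m/n]*n b n) ⟩
  ∣ a % n + a / n * n - b % n + b / n * n ∣ ≡⟨ cong (λ r → ∣ a % n + a / n * n - r + b / n * n ∣) (sym eq) ⟩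
  ∣ a % n + a / n * n - a % n + b / n * n ∣ ≡⟨ ∣m+n-m+o∣≡∣n-o∣ (a % n) _ _ ⟩
  ∣ a / n * n - b / n * n ∣                 ≡⟨ sym (*-distribʳ-∣-∣ n (a / n) (b / n)) ⟩
  ∣ a / n - b / n ∣ * n                     ∎)

∣∣-∣⇒%≡% : ∀ a b n .{{_ : NonZero n}} → n ∣ ∣ a - b ∣ → a % n ≡ b % n
∣∣-∣⇒%≡% a b n n∣∣a-b∣ with ≤-total a b
... | inj₁ a≤b with d , refl ← m≤n⇒∃[o]m+o≡n a≤b =
  sym (%-remove-+ʳ a (subst (n ∣_) (∣m-m+n∣≡n a d) n∣∣a-b∣))
... | inj₂ b≤a with d , refl ← m≤n⇒∃[o]m+o≡n b≤a =
  %-remove-+ʳ b (subst (n ∣_) (trans (∣-∣-comm (b + d) b) (∣m-m+n∣≡n b d)) n∣∣a-b∣)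

+-congʳ-% : ∀ a b c n .{{_ : NonZero n}} → a % n ≡ b % n → (a + c) % n ≡ (b + c) % n
+-congʳ-% a b c n eq = begin
  (a + c) % n             ≡⟨ %-distribˡ-+ a c n ⟩
  (a % n + c % n) % n     ≡⟨ cong (λ r → (r + c % n) % n) eq ⟩
  (b % n + c % n) % n     ≡⟨ %-distribˡ-+ b c n ⟨
  (b + c) % n             ∎

*-congʳ-% : ∀ a b c n .{{_ : NonZero n}} → a % n ≡ b % n → (a * c) % n ≡ (b * c) % n
*-congʳ-% a b c n eq = begin
  (a * c) % n             ≡⟨ %-distribˡ-* a c n ⟩
  (a % n * (c % n)) % n   ≡⟨ cong (λ r → (r * (c % n)) % n) eq ⟩
  (b % n * (c % n)) % n   ≡⟨ %-distribˡ-* b c n ⟨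
  (b * c) % n             ∎

+-cancelˡ-% : ∀ c a b n .{{_ : NonZero n}} → (c + a) % n ≡ (c + b) % n → a % n ≡ b % n
+-cancelˡ-% c a b n eq =
  ∣∣-∣⇒%≡% a b n (subst (n ∣_) (∣m+n-m+o∣≡∣n-o∣ c a b) (%≡%⇒∣∣-∣ (c + a) (c + b) n eq))

*-cancelˡ-%-prime : ∀ {p u} a b .{{_ : NonZero p}} → Prime p → ¬ p ∣ u →
                    (u * a) % p ≡ (u * b) % p → a % p ≡ b % p
*-cancelˡ-%-prime {p} {u} a b p-prime p∤u eq =
  ∣∣-∣⇒%≡% a b p (fromInj₂ (λ p∣u → contradiction p∣u p∤u) (euclidsLemma u ∣ a - b ∣ p-prime p∣u∣a-b∣))
  where
  p∣u∣a-b∣ : p ∣ u * ∣ a - b ∣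
  p∣u∣a-b∣ = subst (p ∣_) (sym (*-distribˡ-∣-∣ u a b)) (%≡%⇒∣∣-∣ (u * a) (u * b) p eq)

[m%n]^k%n≡m^k%n : ∀ m k n .{{_ : NonZero n}} → (m % n) ^ k % n ≡ m ^ k % n
[m%n]^k%n≡m^k%n m zero    n = refl
[m%n]^k%n≡m^k%n m (suc k) n = begin
  (m % n * (m % n) ^ k) % n           ≡⟨ %-distribˡ-* (m % n) ((m % n) ^ k) n ⟩
  (m % n % n * ((m % n) ^ k % n)) % n ≡⟨ cong₂ (λ a b → (a * b) % n) (m%n%n≡m%n m n) ([m%n]^k%n≡m^k%n m k n) ⟩
  (m % n * (m ^ k % n)) % n           ≡⟨ %-distribˡ-* m (m ^ k) n ⟨
  (m * m ^ k) % n                     ∎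

gcd[m%n,n]≡gcd[m,n] : ∀ m n .{{_ : NonZero n}} → gcd (m % n) n ≡ gcd m n
gcd[m%n,n]≡gcd[m,n] m n = ∣-antisym
  (gcd-greatest (∣n∣m%n⇒∣m (gcd[m,n]∣n (m % n) n) (gcd[m,n]∣m (m % n) n)) (gcd[m,n]∣n (m % n) n))
  (gcd-greatest (%-presˡ-∣ (gcd[m,n]∣m m n) (gcd[m,n]∣n m n)) (gcd[m,n]∣n m n))

%≡%⇒gcd≡ : ∀ a b n .{{_ : NonZero n}} → a % n ≡ b % n → gcd a n ≡ gcd b n
%≡%⇒gcd≡ a b n eq = begin
  gcd a n       ≡⟨ gcd[m%n,n]≡gcd[m,n] a n ⟨
  gcd (a % n) n ≡⟨ cong (λ r → gcd r n) eq ⟩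
  gcd (b % n) n ≡⟨ gcd[m%n,n]≡gcd[m,n] b n ⟩
  gcd b n       ∎

gcd≢1⇒1<gcd : ∀ a n .{{_ : NonZero n}} → gcd a n ≢ 1 → 1 < gcd a n
gcd≢1⇒1<gcd a n gcd≢1 =
  ≤∧≢⇒< (n≢0⇒n>0 (gcd[m,n]≢0 a n (inj₂ (≢-nonZero⁻¹ n)))) (λ 1≡gcd → gcd≢1 (sym 1≡gcd))

coprime⇒inverse : ∀ k n .{{_ : NonZero n}} → gcd k n ≡ 1 → ∃ λ u → (k * u) % n ≡ 1 % n
coprime⇒inverse k (suc m) k⊥n with coprime-Bézout (gcd≡1⇒coprime k⊥n)
... | Bézout.+- x y 1+yn≡xk = x , (begin
  (k * x) % suc m           ≡⟨ cong (_% suc m) (trans (*-comm k x) (sym 1+yn≡xk)) ⟩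
  (1 + y * suc m) % suc m   ≡⟨ [m+kn]%n≡m%n 1 y (suc m) ⟩
  1 % suc m                 ∎)
-- Here x k ≡ -1 modulo n, so x (n - 1) inverts k.
... | Bézout.-+ x y 1+xk≡yn = x * m , (begin
  (k * (x * m)) % suc m                 ≡⟨ [m+kn]%n≡m%n (k * (x * m)) y (suc m) ⟨
  (k * (x * m) + y * suc m) % suc m     ≡⟨ cong (λ r → (k * (x * m) + r) % suc m) (sym 1+xk≡yn) ⟩
  (k * (x * m) + (1 + x * k)) % suc m   ≡⟨ cong (_% suc m) (ring k x m) ⟩
  (1 + k * x * suc m) % suc m           ≡⟨ [m+kn]%n≡m%n 1 (k * x) (suc m) ⟩
  1 % suc m                             ∎)
  where
  ring : ∀ k x m → k * (x * m) + (1 + x * k) ≡ 1 + k * x * suc m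
  ring = solve-∀

-- For x = 1, where ∣ x - 2 ∣ = 1, the hypothesis says n ∣ a + 1, so a is coprime to n as well.
gcd∣x-2∣≡gcd : ∀ a x n .{{_ : NonZero n}} → 0 < x → (2 + a) % n ≡ x % n → gcd ∣ x - 2 ∣ n ≡ gcd a n
gcd∣x-2∣≡gcd a (suc zero) n _ eq = trans (gcd-zeroˡ n) (sym (∣1⇒≡1 gcd∣1))
  where
  gcd∣1+a : gcd a n ∣ 1 + a
  gcd∣1+a = ∣-trans (gcd[m,n]∣n a n) (%≡%⇒∣∣-∣ (2 + a) 1 n eq)
  gcd∣1 : gcd a n ∣ 1
  gcd∣1 = ∣m+n∣m⇒∣n (subst (gcd a n ∣_) (+-comm 1 a) gcd∣1+a) (gcd[m,n]∣m a n)
gcd∣x-2∣≡gcd a (suc (suc w)) n _ eq = begin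
  gcd ∣ w - 0 ∣ n ≡⟨ cong (λ r → gcd r n) (∣-∣-identityʳ w) ⟩
  gcd w n         ≡⟨ %≡%⇒gcd≡ a w n (+-cancelˡ-% 2 a w n eq) ⟨
  gcd a n         ∎

2∣2+s+s : ∀ s → 2 ∣ 2 + (s + s)
2∣2+s+s s = divides (suc s) (2+s+s≡[1+s]*2 s)
  where
  2+s+s≡[1+s]*2 : ∀ s → 2 + (s + s) ≡ (1 + s) * 2
  2+s+s≡[1+s]*2 = solve-∀

even⊎odd : ∀ x → 2 ∣ x ⊎ ∃ λ s → x ≡ 1 + (s + s)
even⊎odd zero = inj₁ (divides 0 refl)
even⊎odd (suc x) with even⊎odd x
... | inj₁ (divides s refl) = inj₂ (s , cong suc (s*2≡s+s s))
  where
  s*2≡s+s : ∀ s → s * 2 ≡ s + s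
  s*2≡s+s = solve-∀
... | inj₂ (s , refl)       = inj₁ (2∣2+s+s s)

prime≢2⇒2∣pred : ∀ {n} → Prime (suc n) → suc n ≢ 2 → 2 ∣ n
prime≢2⇒2∣pred {n} p-prime p≢2 with even⊎odd n
... | inj₁ 2∣n = 2∣n
... | inj₂ (s , refl) with prime⇒irreducible p-prime (2∣2+s+s s)
...   | inj₁ ()
...   | inj₂ 2≡p = contradiction (sym 2≡p) p≢2

coprime⇒odd : ∀ {n} x → 2 ∣ n → gcd x n ≡ 1 → ∃ λ s → x ≡ 1 + (s + s)
coprime⇒odd x 2∣n x⊥n with even⊎odd x
... | inj₂ odd = odd
... | inj₁ 2∣x with ∣1⇒≡1 (subst (2 ∣_) x⊥n (gcd-greatest 2∣x 2∣n))
...   | ()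

unit-index : ∀ {n a} → Unit (suc n) a → Fin n
unit-index {a = suc a} (_ , s<s a<n) = fromℕ< a<n

unit-index-injective : ∀ {n a b} (a-unit : Unit (suc n) a) (b-unit : Unit (suc n) b) →
                       unit-index a-unit ≡ unit-index b-unit → a ≡ b
unit-index-injective {a = suc a} {suc b} (_ , s<s a<n) (_ , s<s b<n) eq =
  cong suc (fromℕ<-injective a b a<n b<n eq)

¬p∣a⇒¬p∣a^k : ∀ {p a} → Prime p → ¬ p ∣ a → ∀ k → ¬ p ∣ a ^ k
¬p∣a⇒¬p∣a^k p-prime p∤a zero    p∣1 = ¬prime[1] (subst Prime (∣1⇒≡1 p∣1) p-prime)
¬p∣a⇒¬p∣a^k p-prime p∤a (suc k) p∣aaᵏ with euclidsLemma _ _ p-prime p∣aaᵏ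
... | inj₁ p∣a  = p∤a p∣a
... | inj₂ p∣aᵏ = ¬p∣a⇒¬p∣a^k p-prime p∤a k p∣aᵏ

-- Parametrised by m = p - 2, so that the p ∸ 1 and p ∸ 2 of InA and inv reduce to n and m.
module PrimitiveRoot (m : ℕ) (p-prime : Prime (suc (suc m)))
                     {g : ℕ} (g-gen : IsGenerator (suc (suc m)) g) where

  n p : ℕ
  n = suc m
  p = suc n

  exp : ℕ → ℕ
  exp k = g ^ k % p

  log : ∀ a → Unit p a → ℕ
  log a a-unit = proj₁ (proj₂ g-gen a a-unit)

  exp-log : ∀ a a-unit → exp (log a a-unit) ≡ a
  exp-log a a-unit = proj₂ (proj₂ g-gen a a-unit)

  g<p : g < p
  g<p = proj₂ (proj₁ g-gen)

  exp-1 : exp 1 ≡ g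
  exp-1 = trans (cong (_% p) (*-identityʳ g)) (m<n⇒m%n≡m g<p)

  p∤gᵏ : ∀ k → ¬ p ∣ g ^ k
  p∤gᵏ = ¬p∣a⇒¬p∣a^k p-prime (λ p∣g → <⇒≱ g<p (∣⇒≤ {{>-nonZero (proj₁ (proj₁ g-gen))}} p∣g))

  exp-unit : ∀ k → Unit p (exp k)
  exp-unit k = n≢0⇒n>0 (λ gᵏ%p≡0 → p∤gᵏ k (m%n≡0⇒n∣m (g ^ k) p gᵏ%p≡0)) , m%n<n (g ^ k) p

  exp-+ : ∀ a b → exp (a + b) ≡ exp a * exp b % p
  exp-+ a b = trans (cong (_% p) (^-distribˡ-+-* g a b)) (%-distribˡ-* (g ^ a) (g ^ b) p)

  exp-* : ∀ a b → exp a ^ b % p ≡ exp (a * b)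
  exp-* a b = trans ([m%n]^k%n≡m^k%n (g ^ a) b p) (cong (_% p) (^-*-assoc g a b))

  exp-cancel : ∀ a d → exp (a + d) ≡ exp a → exp d ≡ 1
  exp-cancel a d eq = *-cancelˡ-%-prime (g ^ d) 1 p-prime (p∤gᵏ a) (begin
    (g ^ a * g ^ d) % p ≡⟨ cong (_% p) (^-distribˡ-+-* g a d) ⟨
    exp (a + d)         ≡⟨ eq ⟩
    exp a               ≡⟨ cong (_% p) (*-identityʳ (g ^ a)) ⟨
    (g ^ a * 1) % p     ∎)

  exp-periodic : ∀ d → exp d ≡ 1 → ∀ a k → exp (a + k * d) ≡ exp a
  exp-periodic d exp-d≡1 a k = begin
    exp (a + k * d)             ≡⟨ exp-+ a (k * d) ⟩
    exp a * exp (k * d) % p     ≡⟨ cong (λ e → exp a * exp e % p) (*-comm k d) ⟩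
    exp a * exp (d * k) % p     ≡⟨ cong (λ e → exp a * e % p) (exp-* d k) ⟨
    exp a * (exp d ^ k % p) % p ≡⟨ cong (λ e → exp a * (e ^ k % p) % p) exp-d≡1 ⟩
    exp a * (1 ^ k % p) % p     ≡⟨ cong (λ e → exp a * (e % p) % p) (^-zeroˡ k) ⟩
    exp a * 1 % p               ≡⟨ cong (_% p) (*-identityʳ (exp a)) ⟩
    exp a % p                   ≡⟨ m%n%n≡m%n (g ^ a) p ⟩
    exp a                       ∎

  exp-% : ∀ d .{{_ : NonZero d}} → exp d ≡ 1 → ∀ a → exp (a % d) ≡ exp a
  exp-% d exp-d≡1 a = begin
    exp (a % d)             ≡⟨ exp-periodic d exp-d≡1 (a % d) (a / d) ⟨
    exp (a % d + a / d * d) ≡⟨ cong exp (m≡m%n+[m/n]*n a d) ⟨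
    exp a                   ∎

  -- A period d makes the logarithms of the n units pairwise distinct modulo d.
  period≥n : ∀ d → 0 < d → exp d ≡ 1 → n ≤ d
  period≥n d 0<d exp-d≡1 = injective⇒≤ residue-injective
    where
    instance
      d≢0 : NonZero d
      d≢0 = >-nonZero 0<d
    log-suc : Fin n → ℕ
    log-suc i = log (suc (toℕ i)) (z<s , s<s (toℕ<n i))
    residue : Fin n → Fin d
    residue i = fromℕ< (m%n<n (log-suc i) d)
    exp-residue : ∀ i → exp (toℕ (residue i)) ≡ suc (toℕ i)
    exp-residue i = begin
      exp (toℕ (residue i)) ≡⟨ cong exp (toℕ-fromℕ< (m%n<n (log-suc i) d)) ⟩
      exp (log-suc i % d)   ≡⟨ exp-% d exp-d≡1 (log-suc i) ⟩
      exp (log-suc i)       ≡⟨ exp-log (suc (toℕ i)) _ ⟩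
      suc (toℕ i)           ∎
    residue-injective : Injective _≡_ _≡_ residue
    residue-injective {i} {j} eq = toℕ-injective (suc-injective (begin
      suc (toℕ i)           ≡⟨ exp-residue i ⟨
      exp (toℕ (residue i)) ≡⟨ cong (λ k → exp (toℕ k)) eq ⟩
      exp (toℕ (residue j)) ≡⟨ exp-residue j ⟩
      suc (toℕ j)           ∎))

  -- Pigeonhole on g⁰, …, gⁿ, which take only n values.
  ∃period≤n : ∃ λ d → 0 < d × d ≤ n × exp d ≡ 1
  ∃period≤n with pigeonhole (n<1+n n) (λ k → unit-index (exp-unit (toℕ k)))
  ... | i , j , i<j , eq = d , m<n⇒0<n∸m i<j , ≤-trans (m∸n≤m (toℕ j) (toℕ i)) (toℕ≤pred[n] j) ,
                           exp-cancel (toℕ i) d (trans (cong exp (m+[n∸m]≡n (<⇒≤ i<j))) exp-j≡exp-i)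
    where
    d : ℕ
    d = toℕ j ∸ toℕ i
    exp-j≡exp-i : exp (toℕ j) ≡ exp (toℕ i)
    exp-j≡exp-i = sym (unit-index-injective (exp-unit (toℕ i)) (exp-unit (toℕ j)) eq)

  exp-n : exp n ≡ 1
  exp-n = period≤n⇒exp-n ∃period≤n
    where
    period≤n⇒exp-n : (∃ λ d → 0 < d × d ≤ n × exp d ≡ 1) → exp n ≡ 1
    period≤n⇒exp-n (d , 0<d , d≤n , exp-d≡1) =
      subst (λ e → exp e ≡ 1) (≤-antisym d≤n (period≥n d 0<d exp-d≡1)) exp-d≡1

  period<n⇒≡0 : ∀ d → d < n → exp d ≡ 1 → d ≡ 0
  period<n⇒≡0 zero    _   _         = refl
  period<n⇒≡0 (suc d) d<n exp-d≡1 = contradiction (period≥n (suc d) z<s exp-d≡1) (<⇒≱ d<n)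

  exp-cong : ∀ a b → a % n ≡ b % n → exp a ≡ exp b
  exp-cong a b eq = begin
    exp a       ≡⟨ exp-% n exp-n a ⟨
    exp (a % n) ≡⟨ cong exp eq ⟩
    exp (b % n) ≡⟨ exp-% n exp-n b ⟩
    exp b       ∎

  exp-+-injective : ∀ a d → exp (a + d) ≡ exp a → (a + d) % n ≡ a % n
  exp-+-injective a d eq = %-remove-+ʳ a (m%n≡0⇒n∣m d n d%n≡0)
    where
    d%n≡0 : d % n ≡ 0
    d%n≡0 = period<n⇒≡0 (d % n) (m%n<n d n) (trans (exp-% n exp-n d) (exp-cancel a d eq))

  exp-injective : ∀ a b → exp a ≡ exp b → a % n ≡ b % n
  exp-injective a b eq with ≤-total a b
  ... | inj₁ a≤b with d , refl ← m≤n⇒∃[o]m+o≡n a≤b = sym (exp-+-injective a d (sym eq))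
  ... | inj₂ b≤a with d , refl ← m≤n⇒∃[o]m+o≡n b≤a = exp-+-injective b d eq

  g*exp : ∀ k → g * exp k % p ≡ exp (1 + k)
  g*exp k = begin
    g * exp k % p     ≡⟨ cong (λ h → h * exp k % p) exp-1 ⟨
    exp 1 * exp k % p ≡⟨ exp-+ 1 k ⟨
    exp (1 + k)       ∎

  g⁻¹*exp : ∀ k → inv p g * exp k % p ≡ exp (m + k)
  g⁻¹*exp k = sym (exp-+ m k)

  coprime⇒IsGenerator : ∀ k → gcd k n ≡ 1 → IsGenerator p (exp k)
  coprime⇒IsGenerator k k⊥n = exp-unit k , λ a a-unit → u * log a a-unit , (begin
      exp k ^ (u * log a a-unit) % p ≡⟨ exp-* k (u * log a a-unit) ⟩
      exp (k * (u * log a a-unit))   ≡⟨ exp-cong (k * (u * log a a-unit)) (log a a-unit) (k*u*l≡l (log a a-unit)) ⟩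
      exp (log a a-unit)             ≡⟨ exp-log a a-unit ⟩
      a                              ∎)
    where
    u : ℕ
    u = proj₁ (coprime⇒inverse k n k⊥n)
    k*u*l≡l : ∀ l → (k * (u * l)) % n ≡ l % n
    k*u*l≡l l = begin
      (k * (u * l)) % n ≡⟨ cong (_% n) (*-assoc k u l) ⟨
      (k * u * l) % n   ≡⟨ *-congʳ-% (k * u) 1 l n (proj₂ (coprime⇒inverse k n k⊥n)) ⟩
      (1 * l) % n       ≡⟨ cong (_% n) (*-identityˡ l) ⟩
      l % n             ∎

  IsGenerator⇒coprime : ∀ k → IsGenerator p (exp k) → gcd k n ≡ 1
  IsGenerator⇒coprime k (_ , exp-k-generates) with j , exp-kj≡g ← exp-k-generates g (proj₁ g-gen) =
    ∣1⇒≡1 (subst (gcd k n ∣_) gcd[kj,n]≡1 gcd[k,n]∣gcd[kj,n])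
    where
    gcd[k,n]∣gcd[kj,n] : gcd k n ∣ gcd (k * j) n
    gcd[k,n]∣gcd[kj,n] = gcd-greatest (∣-trans (gcd[m,n]∣m k n) (m∣m*n j)) (gcd[m,n]∣n k n)
    kj≡1 : (k * j) % n ≡ 1 % n
    kj≡1 = exp-injective (k * j) 1 (trans (sym (exp-* k j)) (trans exp-kj≡g (sym exp-1)))
    gcd[kj,n]≡1 : gcd (k * j) n ≡ 1
    gcd[kj,n]≡1 = trans (%≡%⇒gcd≡ (k * j) 1 n kj≡1) (gcd-zeroˡ n)

  exp-even-IsQR : ∀ t → IsQR p (exp (t + t))
  exp-even-IsQR t = exp-unit (t + t) , g ^ t , cong (_% p) (sym (^-distribˡ-+-* g t t))

  IsQR⇒exp-even : ∀ {r} → IsQR p r → ∃ λ t → r ≡ exp (t + t)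
  IsQR⇒exp-even {r} ((0<r , _) , y , y²≡r) = t , (begin
    r                         ≡⟨ y²≡r ⟨
    (y * y) % p               ≡⟨ %-distribˡ-* y y p ⟩
    (y % p * (y % p)) % p     ≡⟨ cong (λ z → (z * z) % p) (exp-log (y % p) y-unit) ⟨
    (exp t * exp t) % p       ≡⟨ exp-+ t t ⟨
    exp (t + t)               ∎)
    where
    y%p≢0 : y % p ≢ 0
    y%p≢0 y%p≡0 = <⇒≢ 0<r (sym (begin
      r                     ≡⟨ y²≡r ⟨
      (y * y) % p           ≡⟨ %-distribˡ-* y y p ⟩
      (y % p * (y % p)) % p ≡⟨ cong (λ z → (z * z) % p) y%p≡0 ⟩
      0                     ∎))
    y-unit : Unit p (y % p)
    y-unit = n≢0⇒n>0 y%p≢0 , m%n<n y p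
    t : ℕ
    t = log (y % p) y-unit

  exp-even-InI : ∀ t → gcd (1 + (t + t)) n ≡ 1 → gcd (m + (t + t)) n ≡ 1 → InI p g (exp (t + t))
  exp-even-InI t 1+2t⊥n m+2t⊥n = (exp-even-IsQR t , g·g²ᵗ-generates) , (exp-even-IsQR t , g⁻¹·g²ᵗ-generates)
    where
    g·g²ᵗ-generates : IsGenerator p (g * exp (t + t) % p)
    g·g²ᵗ-generates = subst (IsGenerator p) (sym (g*exp (t + t))) (coprime⇒IsGenerator (1 + (t + t)) 1+2t⊥n)
    g⁻¹·g²ᵗ-generates : IsGenerator p (inv p g * exp (t + t) % p)
    g⁻¹·g²ᵗ-generates = subst (IsGenerator p) (sym (g⁻¹*exp (t + t))) (coprime⇒IsGenerator (m + (t + t)) m+2t⊥n)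

  record EvenExponentInI (r : ℕ) : Set where
    field
      t               : ℕ
      g·r≡exp[1+2t]   : g * r % p ≡ exp (1 + (t + t))
      g⁻¹·r≡exp[m+2t] : inv p g * r % p ≡ exp (m + (t + t))
      1+2t⊥n          : gcd (1 + (t + t)) n ≡ 1
      m+2t⊥n          : gcd (m + (t + t)) n ≡ 1

  InI⇒EvenExponentInI : ∀ {r} → InI p g r → EvenExponentInI r
  InI⇒EvenExponentInI {r} ((r-QR , gr-generates) , (_ , g⁻¹r-generates)) = record
    { t               = t
    ; g·r≡exp[1+2t]   = g·r≡exp[1+2t]
    ; g⁻¹·r≡exp[m+2t] = g⁻¹·r≡exp[m+2t]
    ; 1+2t⊥n          = IsGenerator⇒coprime (1 + (t + t)) (subst (IsGenerator p) g·r≡exp[1+2t] gr-generates)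
    ; m+2t⊥n          = IsGenerator⇒coprime (m + (t + t)) (subst (IsGenerator p) g⁻¹·r≡exp[m+2t] g⁻¹r-generates)
    }
    where
    t : ℕ
    t = proj₁ (IsQR⇒exp-even r-QR)
    r≡exp[2t] : r ≡ exp (t + t)
    r≡exp[2t] = proj₂ (IsQR⇒exp-even r-QR)
    g·r≡exp[1+2t] : g * r % p ≡ exp (1 + (t + t))
    g·r≡exp[1+2t] = trans (cong (λ r → g * r % p) r≡exp[2t]) (g*exp (t + t))
    g⁻¹·r≡exp[m+2t] : inv p g * r % p ≡ exp (m + (t + t))
    g⁻¹·r≡exp[m+2t] = trans (cong (λ r → inv p g * r % p) r≡exp[2t]) (g⁻¹*exp (t + t))

  -- 1 + k and m + k are the exponents of g · gᵏ and g⁻¹ · gᵏ; they differ by 2 modulo n.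
  2+[m+k]≡1+k : ∀ k → (2 + (m + k)) % n ≡ (1 + k) % n
  2+[m+k]≡1+k k = trans (cong (_% n) (ring m k)) ([m+n]%n≡m%n (1 + k) n)
    where
    ring : ∀ m k → 2 + (m + k) ≡ (1 + k) + suc m
    ring = solve-∀

  gcd∣x-2∣≡gcd[m+k] : ∀ x k → 0 < x → x % n ≡ (1 + k) % n → gcd ∣ x - 2 ∣ n ≡ gcd (m + k) n
  gcd∣x-2∣≡gcd[m+k] x k 0<x eq = gcd∣x-2∣≡gcd (m + k) x n 0<x (trans (2+[m+k]≡1+k k) (sym eq))

  gcd[x+2]≡gcd[1+k] : ∀ x k → x % n ≡ (m + k) % n → gcd (x + 2) n ≡ gcd (1 + k) n
  gcd[x+2]≡gcd[1+k] x k eq = %≡%⇒gcd≡ (x + 2) (1 + k) n (begin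
    (x + 2) % n       ≡⟨ +-congʳ-% x (m + k) 2 n eq ⟩
    (m + k + 2) % n   ≡⟨ cong (_% n) (+-comm (m + k) 2) ⟩
    (2 + (m + k)) % n ≡⟨ 2+[m+k]≡1+k k ⟩
    (1 + k) % n       ∎)

  InM⇒InA : 2 ∣ n → ∀ {x} → 0 < x → x < n → InM p g (exp x) → InA n x
  InM⇒InA 2∣n {x} 0<x x<n (x-generates , x∉) =
    0<x , x<n , x⊥n , gcd≢1⇒1<gcd ∣ x - 2 ∣ n ∣x-2∣⊥̸n , gcd≢1⇒1<gcd (x + 2) n x+2⊥̸n
    where
    x⊥n : gcd x n ≡ 1
    x⊥n = IsGenerator⇒coprime x x-generates
    s : ℕ
    s = proj₁ (coprime⇒odd x 2∣n x⊥n)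
    x≡1+2s : x ≡ 1 + (s + s)
    x≡1+2s = proj₂ (coprime⇒odd x 2∣n x⊥n)
    ∣x-2∣⊥̸n : gcd ∣ x - 2 ∣ n ≢ 1
    ∣x-2∣⊥̸n ∣x-2∣⊥n = proj₁ (x∉ (exp (s + s)) (exp-even-InI s 1+2s⊥n m+2s⊥n)) x≡g·g²ˢ
      where
      x≡g·g²ˢ : exp x ≡ g * exp (s + s) % p
      x≡g·g²ˢ = trans (cong exp x≡1+2s) (sym (g*exp (s + s)))
      1+2s⊥n : gcd (1 + (s + s)) n ≡ 1
      1+2s⊥n = subst (λ y → gcd y n ≡ 1) x≡1+2s x⊥n
      m+2s⊥n : gcd (m + (s + s)) n ≡ 1
      m+2s⊥n = trans (sym (gcd∣x-2∣≡gcd[m+k] x (s + s) 0<x (cong (_% n) x≡1+2s))) ∣x-2∣⊥n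
    x+2⊥̸n : gcd (x + 2) n ≢ 1
    x+2⊥̸n x+2⊥n = proj₂ (x∉ (exp (t + t)) (exp-even-InI t 1+2t⊥n m+2t⊥n)) x≡g⁻¹·g²ᵗ
      where
      t : ℕ
      t = suc s
      x≡m+2t : x % n ≡ (m + (t + t)) % n
      x≡m+2t = trans (sym ([m+n]%n≡m%n x n)) (cong (_% n) (trans (cong (_+ n) x≡1+2s) (ring m s)))
        where
        ring : ∀ m s → 1 + (s + s) + suc m ≡ m + (suc s + suc s)
        ring = solve-∀
      x≡g⁻¹·g²ᵗ : exp x ≡ inv p g * exp (t + t) % p
      x≡g⁻¹·g²ᵗ = trans (exp-cong x (m + (t + t)) x≡m+2t) (sym (g⁻¹*exp (t + t)))
      1+2t⊥n : gcd (1 + (t + t)) n ≡ 1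
      1+2t⊥n = trans (sym (gcd[x+2]≡gcd[1+k] x (t + t) x≡m+2t)) x+2⊥n
      m+2t⊥n : gcd (m + (t + t)) n ≡ 1
      m+2t⊥n = trans (sym (%≡%⇒gcd≡ x (m + (t + t)) n x≡m+2t)) x⊥n

  InA⇒InM : ∀ {x} → InA n x → InM p g (exp x)
  InA⇒InM {x} (0<x , _ , x⊥n , 1<gcd∣x-2∣ , 1<gcd[x+2]) = coprime⇒IsGenerator x x⊥n , x∉
    where
    x∉ : ∀ r → InI p g r → exp x ≢ g * r % p × exp x ≢ inv p g * r % p
    x∉ r r∈I = x≢g·r , x≢g⁻¹·r
      where
      open EvenExponentInI (InI⇒EvenExponentInI r∈I)
      x≢g·r : exp x ≢ g * r % p
      x≢g·r eq = <⇒≢ 1<gcd∣x-2∣ (sym (trans (gcd∣x-2∣≡gcd[m+k] x (t + t) 0<x x≡1+2t) m+2t⊥n))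
        where
        x≡1+2t : x % n ≡ (1 + (t + t)) % n
        x≡1+2t = exp-injective x (1 + (t + t)) (trans eq g·r≡exp[1+2t])
      x≢g⁻¹·r : exp x ≢ inv p g * r % p
      x≢g⁻¹·r eq = <⇒≢ 1<gcd[x+2] (sym (trans (gcd[x+2]≡gcd[1+k] x (t + t) x≡m+2t) 1+2t⊥n))
        where
        x≡m+2t : x % n ≡ (m + (t + t)) % n
        x≡m+2t = exp-injective x (m + (t + t)) (trans eq g⁻¹·r≡exp[m+2t])

lemma1 : (p : ℕ) .{{_ : NonZero p}} → Prime p → p ≢ 2 →
         (g : ℕ) → IsGenerator p g →
         (x : ℕ) → 0 < x → x < p ∸ 1 →
         (InM p g ((g ^ x) % p) ⇔ InA (p ∸ 1) x)
lemma1 0 p-prime = contradiction p-prime ¬prime[0]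
lemma1 1 p-prime = contradiction p-prime ¬prime[1]
lemma1 (suc (suc m)) p-prime p≢2 g g-gen x 0<x x<p-1 =
  mk⇔ (InM⇒InA (prime≢2⇒2∣pred p-prime p≢2) 0<x x<p-1) InA⇒InM
  where open PrimitiveRoot m p-prime g-gen
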